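{- Let $\mathsf{L}^\star$ be any of the logics described in the context and $\mathsf{CS}$ any constant specification for it. For every formula $F\in\mathcal{L}_J$: if $\mathsf{L}^\star_{\mathsf{CS}}\vdash F$, then $\mathcal{M},\omega\Vdash F$ for every $\mathsf{L}^\star_{\mathsf{CS}}$-subset model $\mathcal{M}=(W,W_0,V,E)$ and every $\omega\in W_0$.
   Context: Terms $\mathsf{Tm}$ are built from countably many constants $c_i$, countably many variables $x_i$ and one special constant $\mathsf{c}^\star$ by $t::=c_i\mid x_i\mid \mathsf{c}^\star\mid (t+t)\mid\ !t$. Formulas $\mathcal{L}_J$ are built from countably many atomic propositions $p_i$ by $F::=p_i\mid\bot\mid F\to F\mid t:F$ (other connectives are abbreviations). The $\mathsf{c}^\star$-terms are defined inductively: $\mathsf{c}^\star$ is a $\mathsf{c}^\star$-term, and if $c$ is a $\mathsf{c}^\star$-term and $s,t$ are any terms then $s+c$ and $c+t$ are $\mathsf{c}^\star$-terms. Axiom schemes: (cl) all axioms of classical propositional logic; (j+) $s:A\lor t:A\to(s+t):A$; (jc$^\star$) $c:A\land c:(A\to B)\to c:B$ for every $\mathsf{c}^\star$-term $c$; (j4) $t:A\to\ !t:(t:A)$; (jd) $t:\bot\to\bot$; (jt) $t:A\to A$. A logic $\mathsf{L}^\star$ consists of (cl), (j+), (jc$^\star$) together with some subset of $\{$(j4),(jd),(jt)$\}$. A constant specification $\mathsf{CS}$ is a set of pairs $(c,A)$ with $c$ a constant and $A$ an axiom of $\mathsf{L}^\star$. The Hilbert system $\mathsf{L}^\star_{\mathsf{CS}}$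 has the axioms of $\mathsf{L}^\star$ and the rules modus ponens and axiom necessitation: for every $(c,A)\in\mathsf{CS}$ and every $n\ge 0$ infer $!^nc:\,!^{n-1}c:\cdots:\,!c:c:A$, where $!^kc$ denotes $c$ preceded by $k$ occurrences of $!$. An $\mathsf{L}^\star_{\mathsf{CS}}$-subset model is $\mathcal{M}=(W,W_0,V,E)$ where $W$ is a set, $\emptyset\neq W_0\subseteq W$, $V:W\times\mathcal{L}_J\to\{0,1\}$, $E:W\times\mathsf{Tm}\to\mathcal{P}(W)$, such that, writing $[A]=\{\upsilon\in W: V(\upsilon,A)=1\}$ and $W_{MP}=\{\upsilon\in W:$ for all $A,B\in\mathcal{L}_J$, $V(\upsilon,A)=1$ and $V(\upsilon,A\to B)=1$ imply $V(\upsilon,B)=1\}$, for all $\omega\in W_0$, all $s,t\in\mathsf{Tm}$ and all $F,G\in\mathcal{L}_J$: $V(\omega,\bot)=0$; $V(\omega,F\to G)=1$ iff $V(\omega,F)=0$ or $V(\omega,G)=1$; $V(\omega,t:F)=1$ iff $E(\omega,t)\subseteq[F]$; $E(\omega,s+t)\subseteq E(\omega,s)\cap E(\omega,t)$; $E(\omega,\mathsf{c}^\star)\subseteq W_{MP}$; if (jd) is in $\mathsf{L}^\star$ then some $\upsilon\in W_0$ lies in $E(\omega,t)$; if (jt) is in $\mathsf{L}^\star$ then $\omega\in E(\omega,t)$; if (j4) is in $\mathsf{L}^\star$ then $E(\omega,!t)\subseteq\{\upsilon\in W:$ for all $F$, $V(\omega,t:F)=1$ implies $V(\upsilon,t:F)=1\}$;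 for all $(c,A)\in\mathsf{CS}$ and all $n\ge1$: $E(\omega,c)\subseteq[A]$ and $E(\omega,!^nc)\subseteq[!^{n-1}c:\cdots:\,!c:c:A]$. No conditions are imposed at worlds in $W\setminus W_0$. Truth: $\mathcal{M},\omega\Vdash F$ iff $V(\omega,F)=1$. -}

module Defs where

open import Data.Nat using (ℕ; zero; suc)
open import Data.Bool using (Bool; true; false; not; _∨_)
open import Data.Product using (Σ; _×_)
open import Data.Sum using (_⊎_)
open import Relation.Binary.PropositionalEquality using (_≡_)

data Const : Set where
  cst   : ℕ → Const
  cstar : Const

data Tm : Set where
  con  : Const → Tm
  var  : ℕ → Tm
  _⊕_  : Tm → Tm → Tm
  !_   : Tm → Tm

c⋆ : Tm
c⋆ = con cstar

infixr 5 _⇒_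
infixr 8 _∶_
infixr 6 _∨'_
infixr 7 _∧'_

data Fm : Set where
  atom : ℕ → Fm
  ⊥'   : Fm
  _⇒_  : Fm → Fm → Fm
  _∶_  : Tm → Fm → Fm

¬' : Fm → Fm
¬' A = A ⇒ ⊥'

_∨'_ : Fm → Fm → Fm
A ∨' B = ¬' A ⇒ B

_∧'_ : Fm → Fm → Fm
A ∧' B = ¬' (A ⇒ ¬' B)

data IsCstarTerm : Tm → Set where
  base  : IsCstarTerm c⋆
  right : ∀ {c} (s : Tm) → IsCstarTerm c → IsCstarTerm (s ⊕ c)
  left  : ∀ {c} (t : Tm) → IsCstarTerm c → IsCstarTerm (c ⊕ t)

-- Axioms of classical propositional logic: all propositional tautologies,
-- where atoms and justification formulas t : F are treated as prime.
evalB : (Fm → Bool) → Fm → Bool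
evalB v (atom i) = v (atom i)
evalB v ⊥'       = false
evalB v (A ⇒ B)  = not (evalB v A) ∨ evalB v B
evalB v (t ∶ A)  = v (t ∶ A)

Tautology : Fm → Set
Tautology F = (v : Fm → Bool) → evalB v F ≡ true

-- A logic L⋆: (cl),(j+),(jc⋆) plus a chosen subset of {(j4),(jd),(jt)}.
record Logic : Set where
  field
    hasJ4 : Bool
    hasJD : Bool
    hasJT : Bool
open Logic public

data Axiom (L : Logic) : Fm → Set where
  cl  : ∀ {F} → Tautology F → Axiom L F
  j+  : ∀ s t A → Axiom L ((s ∶ A ∨' t ∶ A) ⇒ (s ⊕ t) ∶ A)
  jc  : ∀ {c} → IsCstarTerm c → ∀ A B →
        Axiom L ((c ∶ A ∧' c ∶ (A ⇒ B)) ⇒ c ∶ B)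
  j4  : hasJ4 L ≡ true → ∀ t A → Axiom L (t ∶ A ⇒ (! t) ∶ (t ∶ A))
  jd  : hasJD L ≡ true → ∀ t → Axiom L (t ∶ ⊥' ⇒ ⊥')
  jt  : hasJT L ≡ true → ∀ t A → Axiom L (t ∶ A ⇒ A)

CSpec : Set₁
CSpec = Const → Fm → Set

IsCSFor : Logic → CSpec → Set
IsCSFor L CS = ∀ c A → CS c A → Axiom L A

!^ : ℕ → Tm → Tm
!^ zero    t = t
!^ (suc n) t = ! (!^ n t)

necChain : Const → Fm → ℕ → Fm
necChain c A zero    = con c ∶ A
necChain c A (suc n) = !^ (suc n) (con c) ∶ necChain c A n

data Prf (L : Logic) (CS : CSpec) : Fm → Set where
  ax  : ∀ {F} → Axiom L F → Prf L CS F
  mp  : ∀ {A B} → Prf L CS A → Prf L CS (A ⇒ B) → Prf L CS B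
  nec : ∀ {c A} → CS c A → (n : ℕ) → Prf L CS (necChain c A n)

record SubsetModel (L : Logic) (CS : CSpec) : Set₁ where
  field
    W   : Set
    W₀  : W → Set
    nonempty : Σ W W₀
    V   : W → Fm → Bool
    E   : W → Tm → W → Set

  ⟦_⟧ : Fm → W → Set
  ⟦ A ⟧ υ = V υ A ≡ true

  _⊆_ : (W → Set) → (W → Set) → Set
  X ⊆ Y = ∀ υ → X υ → Y υ

  WMP : W → Set
  WMP υ = ∀ A B → V υ A ≡ true → V υ (A ⇒ B) ≡ true → V υ B ≡ true

  field
    V⊥  : ∀ ω → W₀ ω → V ω ⊥' ≡ false
    V⇒  : ∀ ω → W₀ ω → ∀ F G →
          (V ω (F ⇒ G) ≡ true → (V ω F ≡ false ⊎ V ω G ≡ true)) ×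
          ((V ω F ≡ false ⊎ V ω G ≡ true) → V ω (F ⇒ G) ≡ true)
    V∶  : ∀ ω → W₀ ω → ∀ t F →
          (V ω (t ∶ F) ≡ true → E ω t ⊆ ⟦ F ⟧) ×
          (E ω t ⊆ ⟦ F ⟧ → V ω (t ∶ F) ≡ true)
    E+  : ∀ ω → W₀ ω → ∀ s t →
          E ω (s ⊕ t) ⊆ (λ υ → E ω s υ × E ω t υ)
    Ec⋆ : ∀ ω → W₀ ω → E ω c⋆ ⊆ WMP
    Ejd : hasJD L ≡ true → ∀ ω → W₀ ω → ∀ t → Σ W (λ υ → W₀ υ × E ω t υ)
    Ejt : hasJT L ≡ true → ∀ ω → W₀ ω → ∀ t → E ω t ω
    Ej4 : hasJ4 L ≡ true → ∀ ω → W₀ ω → ∀ t →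
          E ω (! t) ⊆ (λ υ → ∀ F → V ω (t ∶ F) ≡ true → V υ (t ∶ F) ≡ true)
    ECS : ∀ ω → W₀ ω → ∀ c A → CS c A →
          (E ω (con c) ⊆ ⟦ A ⟧) ×
          (∀ n → E ω (!^ (suc n) (con c)) ⊆ ⟦ necChain c A n ⟧)

  _⊩_ : W → Fm → Set
  ω ⊩ F = V ω F ≡ true

module Submission where

open import Data.Bool using (true; false; not; _∨_)
open import Data.Nat using (zero; suc)
open import Data.Product using (_×_; _,_; proj₁; proj₂)
open import Data.Sum using (inj₁; inj₂)
open import Data.Empty using (⊥-elim)
open import Relation.Binary.PropositionalEquality using (_≡_; refl; sym; trans; cong₂)

open import Defs

-- At a normal world ω ∈ W₀ the valuation is classical, so every tautology holds there;
-- each remaining axiom is valid by the matching condition on E, and a c⋆-term only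
-- reaches worlds of W_MP, where (jc⋆) holds. Modus ponens preserves truth at ω, and
-- necessitation is valid because the model conditions on CS hold at every normal world.

module Soundness {L : Logic} {CS : CSpec} (M : SubsetModel L CS) where
  open SubsetModel M

  module AtNormalWorld (ω : W) (ω∈W₀ : W₀ ω) where

    ⇒-homo : ∀ A B → V ω (A ⇒ B) ≡ not (V ω A) ∨ V ω B
    ⇒-homo A B with V ω A in a | V ω B in b
    ... | false | _    = proj₂ (V⇒ ω ω∈W₀ A B) (inj₁ a)
    ... | true  | true = proj₂ (V⇒ ω ω∈W₀ A B) (inj₂ b)
    ... | true  | false with V ω (A ⇒ B) in a⇒b
    ...   | false = refl
    ...   | true with proj₁ (V⇒ ω ω∈W₀ A B) a⇒b
    ...     | inj₁ a≡false rewrite a with () ← a≡false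
    ...     | inj₂ b≡true  rewrite b with () ← b≡true

    V≡evalB : ∀ F → V ω F ≡ evalB (V ω) F
    V≡evalB (atom i) = refl
    V≡evalB ⊥'       = V⊥ ω ω∈W₀
    V≡evalB (A ⇒ B)  = trans (⇒-homo A B) (cong₂ (λ a b → not a ∨ b) (V≡evalB A) (V≡evalB B))
    V≡evalB (t ∶ A)  = refl

    tautology-true : ∀ {F} → Tautology F → V ω F ≡ true
    tautology-true {F} taut = trans (V≡evalB F) (taut (V ω))

    ⇒-intro : ∀ {A B} → (V ω A ≡ true → V ω B ≡ true) → V ω (A ⇒ B) ≡ true
    ⇒-intro {A} {B} f rewrite ⇒-homo A B with V ω A
    ... | false = refl
    ... | true  = f refl

    ⇒-elim : ∀ {A B} → V ω (A ⇒ B) ≡ true → V ω A ≡ true → V ω B ≡ true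
    ⇒-elim {A} {B} a⇒b a rewrite ⇒-homo A B | a = a⇒b

    ⇒-false : ∀ {A B} → V ω (A ⇒ B) ≡ false → V ω A ≡ true × V ω B ≡ false
    ⇒-false {A} {B} a⇒b rewrite ⇒-homo A B with V ω A | V ω B
    ... | true | false = refl , refl
    ... | true | true  with () ← a⇒b
    ... | false | _    with () ← a⇒b

    ¬-true : ∀ {A} → V ω (¬' A) ≡ true → V ω A ≡ false
    ¬-true {A} ¬a rewrite ⇒-homo A ⊥' | V⊥ ω ω∈W₀ with V ω A
    ... | false = refl
    ... | true  with () ← ¬a

    ∨-elim-false : ∀ {A B} → V ω (A ∨' B) ≡ true → V ω A ≡ false → V ω B ≡ true
    ∨-elim-false {A} a∨b a = ⇒-elim a∨b (proj₂ (V⇒ ω ω∈W₀ A ⊥') (inj₁ a))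

    ∧-elim : ∀ {A B} → V ω (A ∧' B) ≡ true → V ω A ≡ true × V ω B ≡ true
    ∧-elim a∧b with ⇒-false (¬-true a∧b)
    ... | a , ¬b = a , proj₁ (⇒-false ¬b)

    ∶-intro : ∀ {t A} → E ω t ⊆ ⟦ A ⟧ → V ω (t ∶ A) ≡ true
    ∶-intro {t} {A} = proj₂ (V∶ ω ω∈W₀ t A)

    ∶-elim : ∀ {t A} → V ω (t ∶ A) ≡ true → E ω t ⊆ ⟦ A ⟧
    ∶-elim {t} {A} = proj₁ (V∶ ω ω∈W₀ t A)

    E-c⋆-term⊆WMP : ∀ {c} → IsCstarTerm c → E ω c ⊆ WMP
    E-c⋆-term⊆WMP base            = Ec⋆ ω ω∈W₀
    E-c⋆-term⊆WMP (right s c⋆-c) υ e = E-c⋆-term⊆WMP c⋆-c υ (proj₂ (E+ ω ω∈W₀ s _ υ e))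
    E-c⋆-term⊆WMP (left t c⋆-c)  υ e = E-c⋆-term⊆WMP c⋆-c υ (proj₁ (E+ ω ω∈W₀ _ t υ e))

    axiom-true : ∀ {F} → Axiom L F → V ω F ≡ true
    axiom-true (cl taut) = tautology-true taut
    axiom-true (j+ s t A) = ⇒-intro λ s∨t → ∶-intro λ υ e →
      let (e-s , e-t) = E+ ω ω∈W₀ s t υ e in
      by-cases s∨t υ e-s e-t
      where
        by-cases : V ω (s ∶ A ∨' t ∶ A) ≡ true → ∀ υ → E ω s υ → E ω t υ → ⟦ A ⟧ υ
        by-cases s∨t υ e-s e-t with V ω (s ∶ A) in s∶A
        ... | true  = ∶-elim s∶A υ e-s
        ... | false = ∶-elim (∨-elim-false s∨t s∶A) υ e-t
    axiom-true (jc c⋆-c A B) = ⇒-intro λ c∧c → let (c∶A , c∶A⇒B) = ∧-elim c∧c in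
      ∶-intro λ υ e → E-c⋆-term⊆WMP c⋆-c υ e A B (∶-elim c∶A υ e) (∶-elim c∶A⇒B υ e)
    axiom-true (j4 j4∈L t A) = ⇒-intro λ t∶A → ∶-intro λ υ e → Ej4 j4∈L ω ω∈W₀ t υ e A t∶A
    axiom-true (jd jd∈L t) = ⇒-intro λ t∶⊥ →
      let (υ , υ∈W₀ , e) = Ejd jd∈L ω ω∈W₀ t in
      ⊥-elim (true≢false (trans (sym (∶-elim t∶⊥ υ e)) (V⊥ υ υ∈W₀)))
      where
        true≢false : true ≡ false → _
        true≢false ()
    axiom-true (jt jt∈L t A) = ⇒-intro λ t∶A → ∶-elim t∶A ω (Ejt jt∈L ω ω∈W₀ t)

    necChain-true : ∀ {c A} → CS c A → ∀ n → V ω (necChain c A n) ≡ true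
    necChain-true {c} {A} cs zero    = ∶-intro (proj₁ (ECS ω ω∈W₀ c A cs))
    necChain-true {c} {A} cs (suc n) = ∶-intro (proj₂ (ECS ω ω∈W₀ c A cs) n)

  open AtNormalWorld

  sound : ∀ {F} → Prf L CS F → ∀ ω → W₀ ω → ω ⊩ F
  sound (ax a)     ω ω∈W₀ = axiom-true ω ω∈W₀ a
  sound (mp p q)   ω ω∈W₀ = ⇒-elim ω ω∈W₀ (sound q ω ω∈W₀) (sound p ω ω∈W₀)
  sound (nec cs n) ω ω∈W₀ = necChain-true ω ω∈W₀ cs n

mainTheorem1 : (L : Logic) (CS : CSpec) → IsCSFor L CS →
    ∀ F → Prf L CS F →
    (M : SubsetModel L CS) → ∀ ω → SubsetModel.W₀ M ω → SubsetModel._⊩_ M ω F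
mainTheorem1 L CS _ F ⊢F M = Soundness.sound M ⊢F
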